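{- Let $m,n$ be positive integers. Then $H_m(n)\in S_m$ if and only if $n\in S_m$; equivalently, $H_m(n)=1$ if and only if $n\in S_m$.
   Context: For $m,n\in\mathbb{N}$, the Schemmel totient function $L_m(n)$ is the number of integers $k\in\{1,\dots,n\}$ such that $\gcd(k+s,n)=1$ for all $s\in\{0,1,\dots,m-1\}$; by convention $L_m(0)=0$. Equivalently, $L_m(1)=1$, and for $n>1$ with $n=\prod_{i=1}^r p_i^{\alpha_i}$, $L_m(n)=0$ if the smallest prime factor of $n$ is $\le m$, and $L_m(n)=\prod_{i} p_i^{\alpha_i-1}(p_i-m)$ otherwise. Iterates: $f^{(1)}=f$, $f^{(k+1)}=f\circ f^{(k)}$. $R_m(n)$ is the least positive integer $k$ with $L_m^{(k)}(n)\in\{0,1\}$, and $H_m(n)=L_m^{(R_m(n))}(n)\in\{0,1\}$. $Q_m=\{q\text{ prime}: H_m(q)=0\}$ and $S_m=\{n\in\mathbb{N}: q\nmid n\text{ for all }q\in Q_m\}$ (so $1\in S_m$, $0\notin S_m$). -}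

module Defs where

open import Data.Nat using (ℕ; zero; suc; _+_; _≤_; _<_; _≡ᵇ_)
open import Data.Nat.GCD using (gcd)
open import Data.Nat.Divisibility using (_∣_)
open import Data.Nat.Primality using (Prime)
open import Data.Bool using (Bool; true; false; _∧_; if_then_else_)
open import Data.Product using (_×_; ∃)
open import Data.Sum using (_⊎_)
open import Relation.Nullary using (¬_)
open import Relation.Binary.PropositionalEquality using (_≡_; _≢_)

allS : ℕ → ℕ → ℕ → Bool
allS zero    k n = true
allS (suc s) k n = (gcd (k + s) n ≡ᵇ 1) ∧ allS s k n

countUpTo : ℕ → ℕ → ℕ → ℕ
countUpTo m n zero    = 0
countUpTo m n (suc j) = (if allS m (suc j) n then 1 else 0) + countUpTo m n j

-- Schemmel totient L_m(n) (gives L_m(0) = 0 automatically)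
L : ℕ → ℕ → ℕ
L m n = countUpTo m n n

iter : (ℕ → ℕ) → ℕ → ℕ → ℕ
iter f zero    x = x
iter f (suc k) x = f (iter f k x)

Terminal : ℕ → Set
Terminal x = x ≡ 0 ⊎ x ≡ 1

IsR : ℕ → ℕ → ℕ → Set
IsR m n k = 1 ≤ k × Terminal (iter (L m) k n)
          × (∀ j → 1 ≤ j → j < k → ¬ Terminal (iter (L m) j n))

HasH : ℕ → ℕ → ℕ → Set
HasH m n h = ∃ λ k → IsR m n k × iter (L m) k n ≡ h

InQ : ℕ → ℕ → Set
InQ m q = Prime q × HasH m q 0

InS : ℕ → ℕ → Set
InS m n = n ≢ 0 × (∀ q → InQ m q → ¬ (q ∣ n))

{-# OPTIONS --safe #-}
-- Cutting [0, p b) into p blocks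
-- of length b gives L_m(p b) = p L_m(b) when p ∣ b, and L_m(p b) = (p − m) L_m(b) when p ∤ b is a prime
-- above m, because t ↦ t b + j then permutes the residues mod p; and L_m(n) = 0 as soon as a prime
-- p ≤ m divides n.  Consequently every p − m = L_m(p) with p ∣ n divides L_m(n), and when all prime
-- factors of n exceed m, every prime divisor of L_m(n) divides n or one of these p − m.
-- Strong induction on n now shows n ∈ S_m ⇔ L_m(n) ∈ S_m: a prime p lies outside Q_m exactly when
-- L_m(p) ∈ S_m, because L_m(p) < p and the orbit of L_m(p) ends in H_m(p) ∈ {0, 1}, of which only 1
-- lies in S_m.  Iterating along the orbit of n gives H_m(n) ∈ S_m ⇔ n ∈ S_m.

module Submission where

open import Defs
open import Data.Bool using (Bool; true; false; T; _∧_; if_then_else_)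
open import Data.Bool.Properties using (T-∧; T-≡; ⇔→≡)
open import Data.List using ([]; _∷_)
open import Data.List.Relation.Unary.All using (_∷_)
open import Data.Nat
open import Data.Nat.Coprimality using (Coprime; coprime⇒gcd≡1; gcd≡1⇒coprime; coprime-divisor; 1-coprimeTo; ¬0-coprimeTo-2+; prime⇒coprime)
  renaming (sym to coprime-sym)
open import Data.Nat.Divisibility
open import Data.Nat.DivMod
open import Data.Nat.GCD using (gcd)
open import Data.Nat.Induction using (<-rec)
open import Data.Nat.Primality using (Prime; euclidsLemma; prime⇒nonZero; prime⇒nonTrivial)
open import Data.Nat.Primality.Factorisation using (factorise)
open import Data.Nat.Properties
open import Data.Product using (∃; ∃-syntax; _×_; _,_; proj₁; proj₂)
open import Data.Product.Function.NonDependent.Propositional using (_×-⇔_)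
open import Data.Sum using (_⊎_; inj₁; inj₂; [_,_]′)
open import Function.Base using (_∘_)
open import Function.Bundles using (_⇔_; mk⇔; Equivalence)
import Function.Properties.Equivalence as ⇔
open import Level using (0ℓ)
import Relation.Binary.Reasoning.Setoid as SetoidReasoning
open import Relation.Binary.PropositionalEquality
open import Relation.Nullary using (¬_; Dec; yes; no; contradiction)
open import Algebra.Properties.CommutativeSemigroup +-commutativeSemigroup using (interchange; x∙yz≈y∙xz; xy∙z≈xz∙y; xy∙z≈zy∙x)

-- Sums over initial segments of ℕ

sumBelow : (ℕ → ℕ) → ℕ → ℕ
sumBelow f zero    = 0
sumBelow f (suc n) = f n + sumBelow f n

sumBelow-cong : ∀ {f g} n → (∀ i → i < n → f i ≡ g i) → sumBelow f n ≡ sumBelow g n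
sumBelow-cong zero    eq = refl
sumBelow-cong (suc n) eq = cong₂ _+_ (eq n ≤-refl) (sumBelow-cong n (λ i i<n → eq i (m≤n⇒m≤1+n i<n)))

sumBelow-const : ∀ c n → sumBelow (λ _ → c) n ≡ n * c
sumBelow-const c zero    = refl
sumBelow-const c (suc n) = cong (c +_) (sumBelow-const c n)

sumBelow-zero : ∀ {f} n → (∀ i → i < n → f i ≡ 0) → sumBelow f n ≡ 0
sumBelow-zero n eq = trans (sumBelow-cong n eq) (trans (sumBelow-const 0 n) (*-zeroʳ n))

sumBelow-+ : ∀ f g n → sumBelow (λ i → f i + g i) n ≡ sumBelow f n + sumBelow g n
sumBelow-+ f g zero    = refl
sumBelow-+ f g (suc n) =
  trans (cong (f n + g n +_) (sumBelow-+ f g n)) (interchange (f n) (g n) (sumBelow f n) (sumBelow g n))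

sumBelow-*ʳ : ∀ f c n → sumBelow (λ i → f i * c) n ≡ sumBelow f n * c
sumBelow-*ʳ f c zero    = refl
sumBelow-*ʳ f c (suc n) = trans (cong (f n * c +_) (sumBelow-*ʳ f c n)) (sym (*-distribʳ-+ c (f n) _))

sumBelow-*ˡ : ∀ c f n → sumBelow (λ i → c * f i) n ≡ c * sumBelow f n
sumBelow-*ˡ c f zero    = sym (*-zeroʳ c)
sumBelow-*ˡ c f (suc n) = trans (cong (c * f n +_) (sumBelow-*ˡ c f n)) (sym (*-distribˡ-+ c (f n) _))

sumBelow-comm : ∀ (h : ℕ → ℕ → ℕ) a b →
  sumBelow (λ i → sumBelow (h i) b) a ≡ sumBelow (λ j → sumBelow (λ i → h i j) a) b
sumBelow-comm h zero    b = sym (sumBelow-zero b (λ _ _ → refl))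
sumBelow-comm h (suc a) b =
  trans (cong (sumBelow (h a) b +_) (sumBelow-comm h a b)) (sym (sumBelow-+ (h a) _ b))

sumBelow-+-range : ∀ f a b → sumBelow f (a + b) ≡ sumBelow f a + sumBelow (λ i → f (a + i)) b
sumBelow-+-range f a zero    = trans (cong (sumBelow f) (+-identityʳ a)) (sym (+-identityʳ _))
sumBelow-+-range f a (suc b) = begin
  sumBelow f (a + suc b)                                      ≡⟨ cong (sumBelow f) (+-suc a b) ⟩
  f (a + b) + sumBelow f (a + b)                              ≡⟨ cong (f (a + b) +_) (sumBelow-+-range f a b) ⟩
  f (a + b) + (sumBelow f a + sumBelow (λ i → f (a + i)) b)  ≡⟨ x∙yz≈y∙xz (f (a + b)) (sumBelow f a) _ ⟩
  sumBelow f a + sumBelow (λ i → f (a + i)) (suc b)           ∎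
  where open ≡-Reasoning

sumBelow-blocks : ∀ f a b → sumBelow f (a * b) ≡ sumBelow (λ t → sumBelow (λ j → f (t * b + j)) b) a
sumBelow-blocks f zero    b = refl
sumBelow-blocks f (suc a) b = begin
  sumBelow f (b + a * b)                                 ≡⟨ cong (sumBelow f) (+-comm b (a * b)) ⟩
  sumBelow f (a * b + b)                                 ≡⟨ sumBelow-+-range f (a * b) b ⟩
  sumBelow f (a * b) + sumBelow (λ j → f (a * b + j)) b  ≡⟨ +-comm (sumBelow f (a * b)) _ ⟩
  sumBelow (λ j → f (a * b + j)) b + sumBelow f (a * b)  ≡⟨ cong (sumBelow (λ j → f (a * b + j)) b +_) (sumBelow-blocks f a b) ⟩
  sumBelow (λ t → sumBelow (λ j → f (t * b + j)) b) (suc a) ∎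
  where open ≡-Reasoning

sumBelow-shift : ∀ f n → sumBelow (λ i → f (suc i)) n + f 0 ≡ f n + sumBelow f n
sumBelow-shift f zero    = +-comm 0 (f 0)
sumBelow-shift f (suc n) = trans (+-assoc (f (suc n)) _ _) (cong (f (suc n) +_) (sumBelow-shift f n))

sumBelow-interval : ∀ f {c n} → c < n → f 0 ≡ 0 → (∀ r → r < c → f (suc r) ≡ 1) → (∀ r → c < r → r < n → f r ≡ 0) →
  sumBelow f n ≡ c
sumBelow-interval f {c} {n} c<n f0≡0 inside outside with m≤n⇒∃[o]m+o≡n c<n
... | d , refl = begin
  sumBelow f (suc c + d)                               ≡⟨ sumBelow-+-range f (suc c) d ⟩
  sumBelow f (suc c) + sumBelow (λ i → f (suc c + i)) d ≡⟨ cong (sumBelow f (suc c) +_) (sumBelow-zero d tail≡0) ⟩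
  sumBelow f (suc c) + 0                               ≡⟨ +-identityʳ _ ⟩
  f c + sumBelow f c                                   ≡⟨ sumBelow-shift f c ⟨
  sumBelow (λ i → f (suc i)) c + f 0                   ≡⟨ cong₂ _+_ (sumBelow-cong c inside) f0≡0 ⟩
  sumBelow (λ _ → 1) c + 0                             ≡⟨ +-identityʳ _ ⟩
  sumBelow (λ _ → 1) c                                 ≡⟨ sumBelow-const 1 c ⟩
  c * 1                                                ≡⟨ *-identityʳ c ⟩
  c                                                    ∎
  where
  open ≡-Reasoning
  tail≡0 : ∀ i → i < d → f (suc c + i) ≡ 0
  tail≡0 i i<d = outside (suc c + i) (s≤s (m≤m+n c i)) (+-monoʳ-< (suc c) i<d)

sumBelow-update : ∀ f g {a} n → a < n → (∀ i → i < n → i ≢ a → f i ≡ g i) →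
  sumBelow f n + g a ≡ sumBelow g n + f a
sumBelow-update f g {a} (suc n) a<1+n agree with a ≟ n
... | yes refl = trans (cong (λ s → f a + s + g a) (sumBelow-cong a (λ i i<a → agree i (m≤n⇒m≤1+n i<a) (<⇒≢ i<a))))
                       (xy∙z≈zy∙x (f a) (sumBelow g a) (g a))
... | no a≢n = begin
  f n + sumBelow f n + g a    ≡⟨ +-assoc (f n) _ _ ⟩
  f n + (sumBelow f n + g a)  ≡⟨ cong₂ _+_ (agree n ≤-refl (a≢n ∘ sym))
                                            (sumBelow-update f g n a<n (λ i i<n → agree i (m≤n⇒m≤1+n i<n))) ⟩
  g n + (sumBelow g n + f a)  ≡⟨ sym (+-assoc (g n) _ _) ⟩
  g n + sumBelow g n + f a    ∎
  where
  open ≡-Reasoning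
  a<n : a < n
  a<n = ≤∧≢⇒< (s≤s⁻¹ a<1+n) a≢n

transpose : ℕ → ℕ → ℕ → ℕ
transpose a b x with x ≟ a | x ≟ b
... | yes _ | _     = b
... | no _  | yes _ = a
... | no _  | no _  = x

transpose-≡ˡ : ∀ a b → transpose a b a ≡ b
transpose-≡ˡ a b with a ≟ a
... | yes _ = refl
... | no a≢a = contradiction refl a≢a

transpose-≡ʳ : ∀ a b → transpose a b b ≡ a
transpose-≡ʳ a b with b ≟ a | b ≟ b
... | yes b≡a | _      = b≡a
... | no _    | yes _  = refl
... | no _    | no b≢b = contradiction refl b≢b

transpose-≢ : ∀ a b {x} → x ≢ a → x ≢ b → transpose a b x ≡ x
transpose-≢ a b {x} x≢a x≢b with x ≟ a | x ≟ b
... | yes x≡a | _       = contradiction x≡a x≢a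
... | no _    | yes x≡b = contradiction x≡b x≢b
... | no _    | no _    = refl

transpose-involutive : ∀ a b x → transpose a b (transpose a b x) ≡ x
transpose-involutive a b x with x ≟ a | x ≟ b
... | yes refl | _        = transpose-≡ʳ x b
... | no _     | yes refl = transpose-≡ˡ a x
... | no x≢a   | no x≢b   = transpose-≢ a b x≢a x≢b

sumBelow-transpose : ∀ f {a} n → a < suc n →
  f a + sumBelow (λ i → f (transpose a n i)) n ≡ f n + sumBelow f n
sumBelow-transpose f {a} n a<1+n with a ≟ n
... | yes refl = cong (f a +_) (sumBelow-cong a (λ i i<a → cong f (transpose-≢ a a (<⇒≢ i<a) (<⇒≢ i<a))))
... | no a≢n = begin
  f a + sumBelow (f ∘ τ) n  ≡⟨ +-comm (f a) _ ⟩
  sumBelow (f ∘ τ) n + f a  ≡⟨ sumBelow-update (f ∘ τ) f n a<n (λ i i<n i≢a → cong f (transpose-≢ a n i≢a (<⇒≢ i<n))) ⟩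
  sumBelow f n + f (τ a)    ≡⟨ cong (λ x → sumBelow f n + f x) (transpose-≡ˡ a n) ⟩
  sumBelow f n + f n        ≡⟨ +-comm (sumBelow f n) (f n) ⟩
  f n + sumBelow f n        ∎
  where
  open ≡-Reasoning
  τ : ℕ → ℕ
  τ = transpose a n
  a<n : a < n
  a<n = ≤∧≢⇒< (s≤s⁻¹ a<1+n) a≢n

-- Composing with the transposition of σ n and n reduces to an injection of [0, n) into itself.
sumBelow-permute : ∀ f σ n → (∀ i → i < n → σ i < n) → (∀ {i j} → i < n → j < n → σ i ≡ σ j → i ≡ j) →
  sumBelow (λ i → f (σ i)) n ≡ sumBelow f n
sumBelow-permute f σ zero    _       _   = refl
sumBelow-permute f σ (suc n) σ<1+n σ-inj = begin
  f a + sumBelow (f ∘ σ) n            ≡⟨ cong (f a +_) (sumBelow-cong n (λ i _ → cong f (sym (transpose-involutive a n (σ i))))) ⟩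
  f a + sumBelow (f ∘ τ ∘ τ ∘ σ) n    ≡⟨ cong (f a +_) (sumBelow-permute (f ∘ τ) (τ ∘ σ) n τσ<n τσ-inj) ⟩
  f a + sumBelow (f ∘ τ) n            ≡⟨ sumBelow-transpose f n (σ<1+n n ≤-refl) ⟩
  f n + sumBelow f n                  ∎
  where
  open ≡-Reasoning
  a : ℕ
  a = σ n
  τ : ℕ → ℕ
  τ = transpose a n
  σ≢a : ∀ {i} → i < n → σ i ≢ a
  σ≢a i<n σi≡a = <⇒≢ i<n (σ-inj (m≤n⇒m≤1+n i<n) ≤-refl σi≡a)
  τσ<n : ∀ i → i < n → τ (σ i) < n
  τσ<n i i<n with σ i ≟ n
  ... | yes σi≡n = subst (_< n) (sym (trans (cong τ σi≡n) (transpose-≡ʳ a n)))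
                     (≤∧≢⇒< (s≤s⁻¹ (σ<1+n n ≤-refl)) (λ a≡n → σ≢a i<n (trans σi≡n (sym a≡n))))
  ... | no σi≢n  = subst (_< n) (sym (transpose-≢ a n (σ≢a i<n) σi≢n))
                     (≤∧≢⇒< (s≤s⁻¹ (σ<1+n i (m≤n⇒m≤1+n i<n))) σi≢n)
  τσ-inj : ∀ {i j} → i < n → j < n → τ (σ i) ≡ τ (σ j) → i ≡ j
  τσ-inj {i} {j} i<n j<n eq = σ-inj (m≤n⇒m≤1+n i<n) (m≤n⇒m≤1+n j<n)
    (trans (sym (transpose-involutive a n (σ i))) (trans (cong τ eq) (transpose-involutive a n (σ j))))

-- Admissibility

𝟙 : Bool → ℕ
𝟙 b = if b then 1 else 0

𝟙-∧ : ∀ x y → 𝟙 (x ∧ y) ≡ 𝟙 x * 𝟙 y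
𝟙-∧ true  y = sym (+-identityʳ (𝟙 y))
𝟙-∧ false y = refl

T-injective : ∀ {x y} → T x ⇔ T y → x ≡ y
T-injective x⇔y = ⇔→≡ (⇔.trans (⇔.sym T-≡) (⇔.trans x⇔y T-≡))

Admissible : ℕ → ℕ → ℕ → Set
Admissible m n k = ∀ s → s < m → Coprime (k + s) n

allS⇔Admissible : ∀ m k n → T (allS m k n) ⇔ Admissible m n k
allS⇔Admissible zero    k n = mk⇔ (λ _ _ ()) (λ _ → _)
allS⇔Admissible (suc m) k n = mk⇔ split join
  where
  split : T (allS (suc m) k n) → Admissible (suc m) n k
  split t s s<1+m with Equivalence.to T-∧ t | s ≟ m
  ... | last , _    | yes refl = gcd≡1⇒coprime (≡ᵇ⇒≡ (gcd (k + s) n) 1 last)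
  ... | _    , rest | no s≢m   = Equivalence.to (allS⇔Admissible m k n) rest s (≤∧≢⇒< (s≤s⁻¹ s<1+m) s≢m)
  join : Admissible (suc m) n k → T (allS (suc m) k n)
  join adm = Equivalence.from T-∧
    ( ≡⇒≡ᵇ (gcd (k + m) n) 1 (coprime⇒gcd≡1 (adm m ≤-refl))
    , Equivalence.from (allS⇔Admissible m k n) (λ s s<m → adm s (m≤n⇒m≤1+n s<m)))

coprime-∣ʳ : ∀ {x a b} → a ∣ b → Coprime x b → Coprime x a
coprime-∣ʳ a∣b coprime (d∣x , d∣a) = coprime (d∣x , ∣-trans d∣a a∣b)

coprime-*ʳ : ∀ {x a b} → Coprime x a → Coprime x b → Coprime x (a * b)
coprime-*ʳ {x} {a} coprime-a coprime-b {d} (d∣x , d∣ab) = coprime-b (d∣x , coprime-divisor d⊥a d∣ab)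
  where
  d⊥a : Coprime d a
  d⊥a (e∣d , e∣a) = coprime-a (∣-trans e∣d d∣x , e∣a)

coprime-periodic : ∀ t {x n} → Coprime (t * n + x) n ⇔ Coprime x n
coprime-periodic t {x} {n} = mk⇔ to from
  where
  to : Coprime (t * n + x) n → Coprime x n
  to coprime (d∣x , d∣n) = coprime (∣m∣n⇒∣m+n (∣n⇒∣m*n t d∣n) d∣x , d∣n)
  from : Coprime x n → Coprime (t * n + x) n
  from coprime (d∣tn+x , d∣n) = coprime (∣m+n∣m⇒∣n d∣tn+x (∣n⇒∣m*n t d∣n) , d∣n)

Admissible-∣ : ∀ m k {a b} → a ∣ b → Admissible m b k → Admissible m a k
Admissible-∣ m k a∣b adm s s<m = coprime-∣ʳ a∣b (adm s s<m)

Admissible-* : ∀ m k a b → Admissible m (a * b) k ⇔ (Admissible m a k × Admissible m b k)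
Admissible-* m k a b = mk⇔
  (λ adm → Admissible-∣ m k (m∣m*n b) adm , Admissible-∣ m k (n∣m*n a) adm)
  (λ (adm-a , adm-b) s s<m → coprime-*ʳ (adm-a s s<m) (adm-b s s<m))

Admissible-periodic : ∀ m n t k → Admissible m n (t * n + k) ⇔ Admissible m n k
Admissible-periodic m n t k = mk⇔ to from
  where
  shift : ∀ s → Coprime (t * n + k + s) n ⇔ Coprime (k + s) n
  shift s = subst (λ x → Coprime x n ⇔ Coprime (k + s) n) (sym (+-assoc (t * n) k s)) (coprime-periodic t)
  to : Admissible m n (t * n + k) → Admissible m n k
  to adm s s<m = Equivalence.to (shift s) (adm s s<m)
  from : Admissible m n k → Admissible m n (t * n + k)
  from adm s s<m = Equivalence.from (shift s) (adm s s<m)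

allS-≡ : ∀ {m k n m′ k′ n′} → Admissible m n k ⇔ Admissible m′ n′ k′ → allS m k n ≡ allS m′ k′ n′
allS-≡ {m} {k} {n} {m′} {k′} {n′} adm⇔ =
  T-injective (⇔.trans (allS⇔Admissible m k n) (⇔.trans adm⇔ (⇔.sym (allS⇔Admissible m′ k′ n′))))

allS-* : ∀ m k a b → allS m k (a * b) ≡ allS m k a ∧ allS m k b
allS-* m k a b = T-injective (⇔.trans (allS⇔Admissible m k (a * b)) (⇔.trans (Admissible-* m k a b)
  (⇔.sym (⇔.trans T-∧ (allS⇔Admissible m k a ×-⇔ allS⇔Admissible m k b)))))

allS-periodic : ∀ m n t k → allS m (t * n + k) n ≡ allS m k n
allS-periodic m n t k = allS-≡ (Admissible-periodic m n t k)

allS-% : ∀ m k n .{{_ : NonZero n}} → allS m k n ≡ allS m (k % n) n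
allS-% m k n = trans (cong (λ x → allS m x n) (trans (m≡m%n+[m/n]*n k n) (+-comm (k % n) _)))
                     (allS-periodic m n (k / n) (k % n))

allS-*-∣ : ∀ m k {a b} → a ∣ b → allS m k (a * b) ≡ allS m k b
allS-*-∣ m k {a} {b} a∣b = allS-≡ (mk⇔ (proj₂ ∘ Equivalence.to (Admissible-* m k a b))
  (λ adm → Equivalence.from (Admissible-* m k a b) (Admissible-∣ m k a∣b adm , adm)))

allS≡true : ∀ {m k n} → Admissible m n k → allS m k n ≡ true
allS≡true {m} {k} {n} adm = Equivalence.to T-≡ (Equivalence.from (allS⇔Admissible m k n) adm)

allS≡false : ∀ {m k n} → ¬ Admissible m n k → allS m k n ≡ false
allS≡false {m} {k} {n} ¬adm with allS m k n | allS⇔Admissible m k n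
... | true  | adm⇔ = contradiction (Equivalence.to adm⇔ _) ¬adm
... | false | _    = refl

-- Values of L_m

-- The count defining L m n, taken over k ∈ [0, n) instead of [1, n]; they agree because admissibility is n-periodic.
L₀ : ℕ → ℕ → ℕ
L₀ m n = sumBelow (λ k → 𝟙 (allS m k n)) n

countUpTo≡sumBelow : ∀ m n j → countUpTo m n j ≡ sumBelow (λ k → 𝟙 (allS m (suc k) n)) j
countUpTo≡sumBelow m n zero    = refl
countUpTo≡sumBelow m n (suc j) = cong (𝟙 (allS m (suc j) n) +_) (countUpTo≡sumBelow m n j)

L≡L₀ : ∀ m n → L m n ≡ L₀ m n
L≡L₀ m n = +-cancelʳ-≡ (f 0) _ _ (begin
  L m n + f 0                               ≡⟨ cong (_+ f 0) (countUpTo≡sumBelow m n n) ⟩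
  sumBelow (λ k → f (suc k)) n + f 0        ≡⟨ sumBelow-shift f n ⟩
  f n + L₀ m n                              ≡⟨ cong (λ k → 𝟙 (allS m k n) + L₀ m n) n≡1*n+0 ⟩
  𝟙 (allS m (1 * n + 0) n) + L₀ m n         ≡⟨ cong (λ b → 𝟙 b + L₀ m n) (allS-periodic m n 1 0) ⟩
  f 0 + L₀ m n                              ≡⟨ +-comm (f 0) _ ⟩
  L₀ m n + f 0                              ∎)
  where
  open ≡-Reasoning
  f : ℕ → ℕ
  f k = 𝟙 (allS m k n)
  n≡1*n+0 : n ≡ 1 * n + 0
  n≡1*n+0 = sym (trans (+-identityʳ (1 * n)) (*-identityˡ n))

L-1 : ∀ m → L m 1 ≡ 1
L-1 m rewrite allS≡true {m} {1} {1} (λ s _ → coprime-sym (1-coprimeTo (1 + s))) = refl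

countUpTo≤ : ∀ m n j → countUpTo m n j ≤ j
countUpTo≤ m n zero    = z≤n
countUpTo≤ m n (suc j) with allS m (suc j) n
... | true  = s≤s (countUpTo≤ m n j)
... | false = m≤n⇒m≤1+n (countUpTo≤ m n j)

L≤ : ∀ m n → L m n ≤ n
L≤ m n = countUpTo≤ m n n

L< : ∀ {m n} → 1 ≤ m → 2 ≤ n → L m n < n
L< {m} {suc n} 1≤m 2≤1+n = ≤-<-trans
  (≤-reflexive (cong (λ b → 𝟙 b + countUpTo m (suc n) n) (allS≡false ¬adm)))
  (s≤s (countUpTo≤ m (suc n) n))
  where
  ¬adm : ¬ Admissible m (suc n) (suc n)
  ¬adm adm = <⇒≢ 2≤1+n (sym (adm 0 1≤m (∣-reflexive (sym (+-identityʳ (suc n))) , ∣-refl)))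

consecutive-multiple : ∀ k d .{{_ : NonZero d}} → ∃[ s ] s < d × d ∣ k + s
consecutive-multiple k d with k % d ≟ 0
... | yes k%d≡0 = 0 , >-nonZero⁻¹ d , subst (d ∣_) (sym (+-identityʳ k)) (m%n≡0⇒n∣m k d k%d≡0)
... | no  k%d≢0 = d ∸ r , ∸-monoʳ-< (n≢0⇒n>0 k%d≢0) r≤d , subst (d ∣_) (sym k+[d∸r]≡[k/d]*d+d) (∣m∣n⇒∣m+n (n∣m*n (k / d)) ∣-refl)
  where
  r : ℕ
  r = k % d
  r≤d : r ≤ d
  r≤d = <⇒≤ (m%n<n k d)
  k+[d∸r]≡[k/d]*d+d : k + (d ∸ r) ≡ (k / d) * d + d
  k+[d∸r]≡[k/d]*d+d = begin
    k + (d ∸ r)                  ≡⟨ cong (_+ (d ∸ r)) (trans (m≡m%n+[m/n]*n k d) (+-comm r _)) ⟩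
    (k / d) * d + r + (d ∸ r)    ≡⟨ +-assoc ((k / d) * d) r _ ⟩
    (k / d) * d + (r + (d ∸ r))  ≡⟨ cong ((k / d) * d +_) (m+[n∸m]≡n r≤d) ⟩
    (k / d) * d + d              ∎
    where open ≡-Reasoning

L≡0 : ∀ {m n p} → Prime p → p ≤ m → p ∣ n → L m n ≡ 0
L≡0 {m} {n} {p} p-prime p≤m p∣n = trans (countUpTo≡sumBelow m n n)
  (sumBelow-zero n (λ k _ → cong 𝟙 (allS≡false (¬admissible (suc k)))))
  where
  instance _ = prime⇒nonZero p-prime
  ¬admissible : ∀ k → ¬ Admissible m n k
  ¬admissible k adm with consecutive-multiple k p
  ... | s , s<p , p∣k+s = nonTrivial⇒≢1 {{prime⇒nonTrivial p-prime}} (adm s (<-≤-trans s<p p≤m) (p∣k+s , p∣n))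

-- For 0 < r < p the admissible residues are exactly 1 ≤ r ≤ p ∸ m: a window r, …, r + m ∸ 1 avoids p iff it ends below p.
L₀-prime : ∀ {m p} → 1 ≤ m → Prime p → m < p → L₀ m p ≡ p ∸ m
L₀-prime {m} {p} 1≤m p-prime m<p = sumBelow-interval (λ r → 𝟙 (allS m r p)) c<p
  (cong 𝟙 (allS≡false (λ adm → ¬0-coprimeTo-2+ (adm 0 1≤m))))
  (λ r r<c → cong 𝟙 (allS≡true λ s s<m → coprime-sym (prime⇒coprime p-prime (window<p r<c s<m))))
  (λ r c<r r<p → cong 𝟙 (allS≡false λ adm → nonTrivial⇒≢1 (adm (p ∸ r) (p∸r<m c<r) (∣-reflexive (sym (m+[n∸m]≡n (<⇒≤ r<p))) , ∣-refl))))
  where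
  instance
    _ = prime⇒nonTrivial p-prime
    _ = prime⇒nonZero p-prime
  c : ℕ
  c = p ∸ m
  c+m≡p : c + m ≡ p
  c+m≡p = m∸n+n≡m (<⇒≤ m<p)
  c<p : c < p
  c<p = ∸-monoʳ-< 1≤m (<⇒≤ m<p)
  window<p : ∀ {r s} → r < c → s < m → suc r + s < p
  window<p r<c s<m = subst (_ <_) c+m≡p (+-mono-≤-< r<c s<m)
  p∸r<m : ∀ {r} → c < r → p ∸ r < m
  p∸r<m {r} c<r = m<n+o⇒m∸n<o p r {{>-nonZero 1≤m}} (subst (_< r + m) c+m≡p (+-monoˡ-< m c<r))

L-prime : ∀ {m p} → 1 ≤ m → Prime p → m < p → L m p ≡ p ∸ m
L-prime {m} {p} 1≤m p-prime m<p = trans (L≡L₀ m p) (L₀-prime 1≤m p-prime m<p)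

L₀-*-∣ : ∀ m {a b} → a ∣ b → L₀ m (a * b) ≡ a * L₀ m b
L₀-*-∣ m {a} {b} a∣b = begin
  sumBelow (λ k → 𝟙 (allS m k (a * b))) (a * b)                 ≡⟨ sumBelow-cong (a * b) (λ k _ → cong 𝟙 (allS-*-∣ m k a∣b)) ⟩
  sumBelow (λ k → 𝟙 (allS m k b)) (a * b)                       ≡⟨ sumBelow-blocks (λ k → 𝟙 (allS m k b)) a b ⟩
  sumBelow (λ t → sumBelow (λ j → 𝟙 (allS m (t * b + j) b)) b) a ≡⟨ sumBelow-cong a (λ t _ → sumBelow-cong b (λ j _ → cong 𝟙 (allS-periodic m b t j))) ⟩
  sumBelow (λ _ → L₀ m b) a                                     ≡⟨ sumBelow-const (L₀ m b) a ⟩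
  a * L₀ m b                                                    ∎
  where open ≡-Reasoning

L-*-∣ : ∀ m {a b} → a ∣ b → L m (a * b) ≡ a * L m b
L-*-∣ m {a} {b} a∣b = trans (L≡L₀ m (a * b)) (trans (L₀-*-∣ m a∣b) (cong (a *_) (sym (L≡L₀ m b))))

[m+n]%d≡m%d⇒d∣n : ∀ m n d .{{_ : NonZero d}} → (m + n) % d ≡ m % d → d ∣ n
[m+n]%d≡m%d⇒d∣n m n d eq = ∣m+n∣m⇒∣n (subst (d ∣_) (sym [m/d]*d+n≡[[m+n]/d]*d) (n∣m*n ((m + n) / d))) (n∣m*n (m / d))
  where
  open ≡-Reasoning
  [m/d]*d+n≡[[m+n]/d]*d : (m / d) * d + n ≡ ((m + n) / d) * d
  [m/d]*d+n≡[[m+n]/d]*d = +-cancelˡ-≡ (m % d) _ _ (begin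
    m % d + ((m / d) * d + n)      ≡⟨ +-assoc (m % d) _ n ⟨
    m % d + (m / d) * d + n        ≡⟨ cong (_+ n) (m≡m%n+[m/n]*n m d) ⟨
    m + n                          ≡⟨ m≡m%n+[m/n]*n (m + n) d ⟩
    (m + n) % d + ((m + n) / d) * d ≡⟨ cong (_+ ((m + n) / d) * d) eq ⟩
    m % d + ((m + n) / d) * d       ∎)

affine-residue-≤-injective : ∀ {p b} j .{{_ : NonZero p}} → Prime p → ¬ p ∣ b →
  ∀ {t u} → t ≤ u → u < p → (u * b + j) % p ≡ (t * b + j) % p → t ≡ u
affine-residue-≤-injective {p} {b} j p-prime p∤b {t} t≤u u<p eq with m≤n⇒∃[o]m+o≡n t≤u
... | zero  , refl = sym (+-identityʳ t)
... | suc e , refl with euclidsLemma (suc e) b p-prime p∣[1+e]*b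
  where
  shift : (t + suc e) * b + j ≡ t * b + j + suc e * b
  shift = trans (cong (_+ j) (*-distribʳ-+ b t (suc e))) (xy∙z≈xz∙y (t * b) (suc e * b) j)
  p∣[1+e]*b : p ∣ suc e * b
  p∣[1+e]*b = [m+n]%d≡m%d⇒d∣n (t * b + j) (suc e * b) p (trans (cong (_% p) (sym shift)) eq)
...   | inj₁ p∣1+e = contradiction (≤-<-trans (∣⇒≤ p∣1+e) (≤-<-trans (m≤n+m (suc e) t) u<p)) (<-irrefl refl)
...   | inj₂ p∣b   = contradiction p∣b p∤b

affine-residue-injective : ∀ {p b} j .{{_ : NonZero p}} → Prime p → ¬ p ∣ b →
  ∀ {t u} → t < p → u < p → (t * b + j) % p ≡ (u * b + j) % p → t ≡ u
affine-residue-injective j p-prime p∤b {t} {u} t<p u<p eq with ≤-total t u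
... | inj₁ t≤u = affine-residue-≤-injective j p-prime p∤b t≤u u<p (sym eq)
... | inj₂ u≤t = sym (affine-residue-≤-injective j p-prime p∤b u≤t t<p eq)

-- Blocks of length b: k = t * b + j.  For fixed j the residues (t * b + j) % p run over all of [0, p).
L₀-*-prime : ∀ {m p b} → 1 ≤ m → Prime p → m < p → ¬ p ∣ b → L₀ m (p * b) ≡ (p ∸ m) * L₀ m b
L₀-*-prime {m} {p} {b} 1≤m p-prime m<p p∤b = begin
  sumBelow (λ k → 𝟙 (allS m k (p * b))) (p * b)                    ≡⟨ sumBelow-cong (p * b) (λ k _ → split k) ⟩
  sumBelow (λ k → F k * G k) (p * b)                               ≡⟨ sumBelow-blocks (λ k → F k * G k) p b ⟩
  sumBelow (λ t → sumBelow (λ j → F (t * b + j) * G (t * b + j)) b) p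
    ≡⟨ sumBelow-cong p (λ t _ → sumBelow-cong b (λ j _ → cong₂ _*_ (cong 𝟙 (allS-% m _ p)) (cong 𝟙 (allS-periodic m b t j)))) ⟩
  sumBelow (λ t → sumBelow (λ j → F (σ j t) * G j) b) p             ≡⟨ sumBelow-comm (λ t j → F (σ j t) * G j) p b ⟩
  sumBelow (λ j → sumBelow (λ t → F (σ j t) * G j) p) b             ≡⟨ sumBelow-cong b (λ j _ → sumBelow-*ʳ (F ∘ σ j) (G j) p) ⟩
  sumBelow (λ j → sumBelow (F ∘ σ j) p * G j) b                    ≡⟨ sumBelow-cong b (λ j _ → cong (_* G j) (residues j)) ⟩
  sumBelow (λ j → (p ∸ m) * G j) b                                 ≡⟨ sumBelow-*ˡ (p ∸ m) G b ⟩
  (p ∸ m) * L₀ m b                                                 ∎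
  where
  open ≡-Reasoning
  instance _ = prime⇒nonZero p-prime
  F G : ℕ → ℕ
  F r = 𝟙 (allS m r p)
  G r = 𝟙 (allS m r b)
  σ : ℕ → ℕ → ℕ
  σ j t = (t * b + j) % p
  split : ∀ k → 𝟙 (allS m k (p * b)) ≡ F k * G k
  split k = trans (cong 𝟙 (allS-* m k p b)) (𝟙-∧ (allS m k p) (allS m k b))
  residues : ∀ j → sumBelow (F ∘ σ j) p ≡ p ∸ m
  residues j = trans (sumBelow-permute F (σ j) p (λ t _ → m%n<n (t * b + j) p) (affine-residue-injective j p-prime p∤b))
                     (L₀-prime 1≤m p-prime m<p)

L-*-prime : ∀ {m p b} → 1 ≤ m → Prime p → m < p → ¬ p ∣ b → L m (p * b) ≡ (p ∸ m) * L m b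
L-*-prime {m} {p} {b} 1≤m p-prime m<p p∤b =
  trans (L≡L₀ m (p * b)) (trans (L₀-*-prime 1≤m p-prime m<p p∤b) (cong ((p ∸ m) *_) (sym (L≡L₀ m b))))

-- Divisors of L_m(n)

prime-cofactor : ∀ {p n} → Prime p → p ∣ n → n ≢ 0 → ∃[ q ] n ≡ p * q × q ≢ 0 × q < n
prime-cofactor {p} {n} p-prime p∣n n≢0 =
  quotient p∣n , m∣n⇒n≡m*quotient p∣n , ≢-nonZero⁻¹ (quotient p∣n) {{quotient≢0 p∣n}} , quotient-< p∣n
  where
  instance
    _ = prime⇒nonTrivial p-prime
    _ = ≢-nonZero n≢0

∃prime-factor : ∀ {n} → 2 ≤ n → ∃[ p ] Prime p × p ∣ n
∃prime-factor {n} 2≤n with factorise n {{>-nonZero (<-trans z<s 2≤n)}}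
... | record { factors = [] ; isFactorisation = n≡1 } = contradiction n≡1 (<⇒≢ 2≤n ∘ sym)
... | record { factors = p ∷ _ ; isFactorisation = n≡p*_ ; factorsPrime = p-prime ∷ _ } =
  p , p-prime , subst (p ∣_) (sym n≡p*_) (m∣m*n _)

∸∣L : ∀ {m p} → 1 ≤ m → Prime p → m < p → ∀ {n} → p ∣ n → (p ∸ m) ∣ L m n
∸∣L {m} {p} 1≤m p-prime m<p {n} = <-rec (λ n → p ∣ n → (p ∸ m) ∣ L m n) step n
  where
  step : ∀ n → (∀ {y} → y < n → p ∣ y → (p ∸ m) ∣ L m y) → p ∣ n → (p ∸ m) ∣ L m n
  step zero    _   _   = (p ∸ m) ∣0
  step (suc n) rec p∣n with prime-cofactor p-prime p∣n (λ ())
  ... | q , n≡p*q , _ , q<n = subst (λ x → (p ∸ m) ∣ L m x) (sym n≡p*q) (p∸m∣L[p*q] (p ∣? q))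
    where
    p∸m∣L[p*q] : Dec (p ∣ q) → (p ∸ m) ∣ L m (p * q)
    p∸m∣L[p*q] (yes p∣q) = subst ((p ∸ m) ∣_) (sym (L-*-∣ m p∣q)) (∣n⇒∣m*n p (rec q<n p∣q))
    p∸m∣L[p*q] (no  p∤q) = subst ((p ∸ m) ∣_) (sym (L-*-prime 1≤m p-prime m<p p∤q)) (m∣m*n (L m q))

L-*-prime-factor : ∀ {m p} → 1 ≤ m → Prime p → m < p → ∀ q → ∃[ c ] L m (p * q) ≡ c * L m q × (c ≡ p ⊎ c ≡ p ∸ m)
L-*-prime-factor {m} {p} 1≤m p-prime m<p q with p ∣? q
... | yes p∣q = p     , L-*-∣ m p∣q                    , inj₁ refl
... | no  p∤q = p ∸ m , L-*-prime 1≤m p-prime m<p p∤q , inj₂ refl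

PrimeFactorsAbove : ℕ → ℕ → Set
PrimeFactorsAbove m n = ∀ p → Prime p → p ∣ n → m < p

PrimeFactorsAbove-∣ : ∀ {m d n} → d ∣ n → PrimeFactorsAbove m n → PrimeFactorsAbove m d
PrimeFactorsAbove-∣ d∣n above p p-prime p∣d = above p p-prime (∣-trans p∣d d∣n)

PrimeFactorsAbove-induction : ∀ {m} (P : ℕ → Set) → P 1 → (∀ {p q} → Prime p → m < p → P q → P (p * q)) →
  ∀ {n} → n ≢ 0 → PrimeFactorsAbove m n → P n
PrimeFactorsAbove-induction {m} P base step {n} = <-rec (λ n → n ≢ 0 → PrimeFactorsAbove m n → P n) go n
  where
  go : ∀ n → (∀ {y} → y < n → y ≢ 0 → PrimeFactorsAbove m y → P y) → n ≢ 0 → PrimeFactorsAbove m n → P n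
  go zero                _   n≢0 _     = contradiction refl n≢0
  go 1                   _   _   _     = base
  go n@(suc (suc _)) rec n≢0 above with ∃prime-factor {n} (s≤s (s≤s z≤n))
  ... | p , p-prime , p∣n with prime-cofactor p-prime p∣n n≢0
  ...   | q , n≡p*q , q≢0 , q<n = subst P (sym n≡p*q)
    (step p-prime (above p p-prime p∣n) (rec q<n q≢0 (PrimeFactorsAbove-∣ (divides p n≡p*q) above)))

L≢0 : ∀ {m n} → 1 ≤ m → n ≢ 0 → PrimeFactorsAbove m n → L m n ≢ 0
L≢0 {m} 1≤m = PrimeFactorsAbove-induction (λ n → L m n ≢ 0) (λ L1≡0 → 1+n≢0 (trans (sym (L-1 m)) L1≡0)) step
  where
  step : ∀ {p q} → Prime p → m < p → L m q ≢ 0 → L m (p * q) ≢ 0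
  step {p} {q} p-prime m<p Lq≢0 with L-*-prime-factor 1≤m p-prime m<p q
  ... | c , L[p*q]≡c*Lq , c≡p⊎p∸m = λ L[p*q]≡0 →
    [ c≢0 c≡p⊎p∸m , Lq≢0 ]′ (m*n≡0⇒m≡0∨n≡0 c (trans (sym L[p*q]≡c*Lq) L[p*q]≡0))
    where
    c≢0 : c ≡ p ⊎ c ≡ p ∸ m → c ≢ 0
    c≢0 (inj₁ refl) = ≢-nonZero⁻¹ p {{prime⇒nonZero p-prime}}
    c≢0 (inj₂ refl) = ≢-nonZero⁻¹ (p ∸ m) {{>-nonZero (m<n⇒0<n∸m m<p)}}

DividesFactorOrShift : ℕ → ℕ → ℕ → Set
DividesFactorOrShift m n r = r ∣ n ⊎ ∃[ p ] Prime p × p ∣ n × m < p × r ∣ p ∸ m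

DividesFactorOrShift-∣ : ∀ {m n n′ r} → n ∣ n′ → DividesFactorOrShift m n r → DividesFactorOrShift m n′ r
DividesFactorOrShift-∣ n∣n′ (inj₁ r∣n) = inj₁ (∣-trans r∣n n∣n′)
DividesFactorOrShift-∣ n∣n′ (inj₂ (p , p-prime , p∣n , m<p , r∣p∸m)) = inj₂ (p , p-prime , ∣-trans p∣n n∣n′ , m<p , r∣p∸m)

prime∣L : ∀ {m n} → 1 ≤ m → n ≢ 0 → PrimeFactorsAbove m n → ∀ r → Prime r → r ∣ L m n → DividesFactorOrShift m n r
prime∣L {m} 1≤m = PrimeFactorsAbove-induction P base step
  where
  P : ℕ → Set
  P n = ∀ r → Prime r → r ∣ L m n → DividesFactorOrShift m n r
  base : P 1
  base r r-prime r∣L1 = contradiction (∣1⇒≡1 (subst (r ∣_) (L-1 m) r∣L1)) (nonTrivial⇒≢1 {{prime⇒nonTrivial r-prime}})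
  step : ∀ {p q} → Prime p → m < p → P q → P (p * q)
  step {p} {q} p-prime m<p ih r r-prime r∣L[p*q] with L-*-prime-factor 1≤m p-prime m<p q
  ... | c , L[p*q]≡c*Lq , c≡p⊎p∸m with euclidsLemma c (L m q) r-prime (subst (r ∣_) L[p*q]≡c*Lq r∣L[p*q])
  ...   | inj₂ r∣Lq = DividesFactorOrShift-∣ (n∣m*n p) (ih r r-prime r∣Lq)
  ...   | inj₁ r∣c with c≡p⊎p∸m
  ...     | inj₁ refl = inj₁ (∣m⇒∣m*n q r∣c)
  ...     | inj₂ refl = inj₂ (p , p-prime , m∣m*n q , m<p , r∣c)

-- Orbits under L_m and the set S_m

iter-suc : ∀ f k x → iter f (suc k) x ≡ iter f k (f x)
iter-suc f zero    x = refl
iter-suc f (suc k) x = cong f (iter-suc f k x)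

terminal? : ∀ x → Dec (Terminal x)
terminal? 0             = yes (inj₁ refl)
terminal? 1             = yes (inj₂ refl)
terminal? (suc (suc x)) = no λ { (inj₁ ()) ; (inj₂ ()) }

InS-1 : ∀ m → InS m 1
InS-1 m = (λ ()) , λ q (q-prime , _) q∣1 → nonTrivial⇒≢1 {{prime⇒nonTrivial q-prime}} (∣1⇒≡1 q∣1)

InS-∣ : ∀ {m d n} → d ∣ n → InS m n → InS m d
InS-∣ d∣n (n≢0 , S) = (λ { refl → n≢0 (0∣⇒≡0 d∣n) }) , λ q Q q∣d → S q Q (∣-trans q∣d d∣n)

Terminal⇒InS⇔≡1 : ∀ {m t} → Terminal t → InS m t ⇔ t ≡ 1
Terminal⇒InS⇔≡1 (inj₁ refl) = mk⇔ (λ (0≢0 , _) → contradiction refl 0≢0) (λ ())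
Terminal⇒InS⇔≡1 (inj₂ refl) = mk⇔ (λ _ → refl) (λ _ → InS-1 _)

IsR-1 : ∀ {m n} → Terminal (L m n) → IsR m n 1
IsR-1 terminal = s≤s z≤n , terminal , λ { (suc j) (s≤s _) (s≤s ()) }

IsR-suc : ∀ {m n k} → ¬ Terminal (L m n) → IsR m (L m n) k → IsR m n (suc k)
IsR-suc {m} {n} {k} ¬terminal (_ , terminal , earlier) =
  s≤s z≤n , subst Terminal (sym (iter-suc (L m) k n)) terminal , earlier′
  where
  earlier′ : ∀ j → 1 ≤ j → j < suc k → ¬ Terminal (iter (L m) j n)
  earlier′ 1             _ _         = ¬terminal
  earlier′ (suc (suc j)) _ (s≤s j<k) = earlier (suc j) (s≤s z≤n) j<k ∘ subst Terminal (iter-suc (L m) (suc j) n)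

R-exists : ∀ {m} → 1 ≤ m → ∀ n → ∃ (IsR m n)
R-exists {m} 1≤m = <-rec (∃ ∘ IsR m) step
  where
  step : ∀ n → (∀ {y} → y < n → ∃ (IsR m y)) → ∃ (IsR m n)
  step n rec with terminal? (L m n)
  ... | yes terminal = 1 , IsR-1 terminal
  ... | no ¬terminal with n
  ...   | 0             = contradiction (inj₁ refl) ¬terminal
  ...   | 1             = contradiction (inj₂ (L-1 m)) ¬terminal
  ...   | suc (suc n′)  with rec (L< 1≤m (s≤s (s≤s z≤n)))
  ...     | k , R = suc k , IsR-suc ¬terminal R

iter-L≤ : ∀ m k x → iter (L m) k x ≤ x
iter-L≤ m zero    x = ≤-refl
iter-L≤ m (suc k) x = ≤-trans (L≤ m _) (iter-L≤ m k x)

InvariantBelow : ℕ → ℕ → Set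
InvariantBelow m x = ∀ {y} → y < x → InS m y ⇔ InS m (L m y)

InS-iter : ∀ {m x y} → InvariantBelow m x → y < x → ∀ k → InS m (iter (L m) k y) ⇔ InS m y
InS-iter         inv y<x zero    = ⇔.refl
InS-iter {m} {y = y} inv y<x (suc k) =
  ⇔.trans (⇔.sym (inv (≤-<-trans (iter-L≤ m k y) y<x))) (InS-iter inv y<x k)

H≡1⇔InS-L : ∀ {m x n k} → InvariantBelow m x → L m n < x → IsR m n k → iter (L m) k n ≡ 1 ⇔ InS m (L m n)
H≡1⇔InS-L {m} {n = n} {suc k} inv Ln<x (_ , terminal , _) = begin
  iter (L m) (suc k) n ≡ 1      ≡⟨ cong (_≡ 1) (iter-suc (L m) k n) ⟩
  iter (L m) k (L m n) ≡ 1      ≈⟨ Terminal⇒InS⇔≡1 (subst Terminal (iter-suc (L m) k n) terminal) ⟨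
  InS m (iter (L m) k (L m n))  ≈⟨ InS-iter inv Ln<x k ⟩
  InS m (L m n)                 ∎
  where open SetoidReasoning (⇔.⇔-setoid 0ℓ)

module _ {m : ℕ} (1≤m : 1 ≤ m) where

  InS-L-prime⇔∉Q : ∀ {x p} → InvariantBelow m x → Prime p → p ≤ x → InS m (L m p) ⇔ (¬ InQ m p)
  InS-L-prime⇔∉Q {x} {p} inv p-prime p≤x = mk⇔ to from
    where
    Lp<x : L m p < x
    Lp<x = <-≤-trans (L< 1≤m (nonTrivial⇒n>1 p {{prime⇒nonTrivial p-prime}})) p≤x
    to : InS m (L m p) → ¬ InQ m p
    to S (_ , _ , R , Hp≡0) = 0≢1+n (trans (sym Hp≡0) (Equivalence.from (H≡1⇔InS-L inv Lp<x R) S))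
    from : ¬ InQ m p → InS m (L m p)
    from p∉Q with R-exists 1≤m p
    ... | k , R@(_ , terminal , _) with terminal
    ...   | inj₁ Hp≡0 = contradiction (p-prime , k , R , Hp≡0) p∉Q
    ...   | inj₂ Hp≡1 = Equivalence.to (H≡1⇔InS-L inv Lp<x R) Hp≡1

  prime≤m⇒InQ : ∀ {p} → Prime p → p ≤ m → InQ m p
  prime≤m⇒InQ {p} p-prime p≤m = p-prime , 1 , IsR-1 (inj₁ Lp≡0) , Lp≡0
    where
    Lp≡0 : L m p ≡ 0
    Lp≡0 = L≡0 p-prime p≤m ∣-refl

  InS⇒InS-L : ∀ {n} → InvariantBelow m n → InS m n → InS m (L m n)
  InS⇒InS-L {n} inv (n≢0 , n∉Q) = L≢0 1≤m n≢0 above , r∤Ln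
    where
    instance _ = ≢-nonZero n≢0
    above : PrimeFactorsAbove m n
    above p p-prime p∣n with m <? p
    ... | yes m<p = m<p
    ... | no  m≮p = contradiction p∣n (n∉Q p (prime≤m⇒InQ p-prime (≮⇒≥ m≮p)))
    r∤Ln : ∀ r → InQ m r → ¬ r ∣ L m n
    r∤Ln r r∈Q r∣Ln with prime∣L 1≤m n≢0 above r (proj₁ r∈Q) r∣Ln
    ... | inj₁ r∣n = n∉Q r r∈Q r∣n
    ... | inj₂ (p , p-prime , p∣n , m<p , r∣p∸m) =
      proj₂ (Equivalence.from (InS-L-prime⇔∉Q inv p-prime (∣⇒≤ p∣n)) (λ p∈Q → n∉Q p p∈Q p∣n)) r r∈Q
        (subst (r ∣_) (sym (L-prime 1≤m p-prime m<p)) r∣p∸m)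

  InS-L⇒InS : ∀ {n} → InvariantBelow m n → InS m (L m n) → InS m n
  InS-L⇒InS {zero}  _   (0≢0 , _)     = contradiction refl 0≢0
  InS-L⇒InS {suc n} inv S@(Ln≢0 , _) = (λ ()) , q∉Q
    where
    q∉Q : ∀ q → InQ m q → ¬ q ∣ suc n
    q∉Q q q∈Q@(q-prime , _) q∣n with m <? q
    ... | no  m≮q = Ln≢0 (L≡0 q-prime (≮⇒≥ m≮q) q∣n)
    ... | yes m<q = Equivalence.to (InS-L-prime⇔∉Q inv q-prime (∣⇒≤ q∣n)) (InS-∣ q∸m∣Ln S) q∈Q
      where
      q∸m∣Ln : L m q ∣ L m (suc n)
      q∸m∣Ln = subst (_∣ L m (suc n)) (sym (L-prime 1≤m q-prime m<q)) (∸∣L 1≤m q-prime m<q q∣n)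

  InS⇔InS-L : ∀ n → InS m n ⇔ InS m (L m n)
  InS⇔InS-L = <-rec (λ n → InS m n ⇔ InS m (L m n)) (λ n inv → mk⇔ (InS⇒InS-L inv) (InS-L⇒InS inv))

corollary1p2 : ∀ (m n : ℕ) → 1 ≤ m → 1 ≤ n →
    (∃ λ k → IsR m n k) ×
    (∀ k → IsR m n k →
      (InS m (iter (L m) k n) ⇔ InS m n) × (iter (L m) k n ≡ 1 ⇔ InS m n))
corollary1p2 m n 1≤m _ = R-exists 1≤m n , λ k (_ , terminal , _) →
  let H∈S⇔n∈S = InS-iter (λ _ → InS⇔InS-L 1≤m _) (n<1+n n) k
  in H∈S⇔n∈S , ⇔.trans (⇔.sym (Terminal⇒InS⇔≡1 terminal)) H∈S⇔n∈S
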